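{- Let $q$ be an odd positive integer, $m\in\mathbb{N}$, $N=q\,2^m$, and let $\mu(q)\ge 0$ be the number of multiplications used for the $q$-point DCT-II. The number of multiplications of C.\,W.~Kok's algorithm for the $N$-point DCT-II, namely $2^m\mu(q)+\tfrac{m}{2}N$, equals the multiplicative complexity theoretically achievable by the prime-factor decomposition, namely $2^m\mu(q)+q\left(2^{m+1}-m-2\right)$, if and only if $m\le 2$.
   Context: The $N$-point DCT-II is $[C^{II}_N]_{n,k}=\cos\left(\frac{\pi(2n+1)k}{2N}\right)$, $n,k=0,\dots,N-1$. C.\,W.~Kok's algorithm computes it recursively via $C^{II}_N=P_N\begin{pmatrix}C^{II}_{N/2}&0\\0&R_{N/2}C^{II}_{N/2}D_{N/2}J_{N/2}\end{pmatrix}B_N$ (with $P_N$ an even/odd permutation, $B_N$ a butterfly, $R_{N/2}$ a matrix of recursive subtractions, $D_{N/2}=\mathrm{diag}(2\cos\frac{(2i+1)\pi}{2N})$, $J_{N/2}$ order reversal), applied $m$ times down to length $q$, giving $2^m\mu(q)+\tfrac{m}{2}N$ multiplications. The prime-factor decomposition computes the length-$q2^m$ DCT-II from $2^m$ transforms of length $q$ and $q$ transforms of length $2^m$, using $2^m\mu(q)+q\,\mu(2^m)$ multiplications, and any $2^m$-point DCT-II requires $\mu(2^m)\ge 2^{m+1}-m-2$ multiplications, so the best achievable prime-factor count is $2^m\mu(q)+q(2^{m+1}-m-2)$. -}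

module Defs where

open import Data.Nat using (ℕ; _+_; _*_; _∸_; _^_)
open import Data.Nat.DivMod using (_/_)
open import Data.Product using (∃)
open import Relation.Binary.PropositionalEquality using (_≡_)

Odd : ℕ → Set
Odd q = ∃ λ k → q ≡ 1 + 2 * k

lengthN : ℕ → ℕ → ℕ
lengthN q m = q * 2 ^ m

-- Kok's count: 2^m μ(q) + (m/2) N.  (m * N is always even, so the
-- natural-number division by 2 is exact.)
kokMults : ℕ → ℕ → ℕ → ℕ
kokMults q m μq = 2 ^ m * μq + (m * lengthN q m) / 2

-- best achievable prime-factor count: 2^m μ(q) + q (2^(m+1) - m - 2)
-- (2^(m+1) ≥ m + 2 always, so truncated subtraction is exact)
primeFactorMults : ℕ → ℕ → ℕ → ℕ
primeFactorMults q m μq = 2 ^ m * μq + q * (2 ^ (m + 1) ∸ m ∸ 2)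

module Submission where

-- Both operation counts share the term 2^m μ(q), and
-- both remaining terms are multiples of q:
--   Kok:          (m/2) N            = q · m 2^(m-1)        (kokPerRow m)
--   prime factor: q (2^(m+1) - m - 2) = q · (2^(m+1) - m - 2) (primeFactorPerRow m)
-- Since q is odd it is nonzero, so after cancelling 2^m μ(q) and the factor q
-- the theorem reduces to a statement about m alone:
--   m 2^(m-1) = 2^(m+1) - m - 2   iff   m ≤ 2.
-- For m ≤ 2 both sides are 0, 1, 4; for m = 3 they are 12 and 11; for m ≥ 4
-- already 2^(m+1) = 4 · 2^(m-1) ≤ m 2^(m-1) exceeds the right-hand side.

open import Defs
open import Data.Nat using (ℕ; _≤_)
open import Function.Bundles using (_⇔_)
open import Relation.Binary.PropositionalEquality using (_≡_)

open import Data.Nat using (zero; suc; _+_; _*_; _∸_; _^_; _<_; z≤n; s≤s; NonZero)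
open import Data.Nat.Properties
open import Data.Nat.DivMod using (_/_; m*n/n≡m)
open import Data.Nat.Solver using (module +-*-Solver)
open import Data.Product using (_,_)
open import Relation.Nullary using (yes; no; contradiction)
open import Function.Bundles using (mk⇔; Equivalence)
open import Relation.Binary.PropositionalEquality
  using (refl; sym; trans; cong; subst; module ≡-Reasoning)

-- Kok's extra multiplications per length-2^m block: (m/2) 2^m = m 2^(m-1).
kokPerRow : ℕ → ℕ
kokPerRow zero    = 0
kokPerRow (suc n) = suc n * 2 ^ n

primeFactorPerRow : ℕ → ℕ
primeFactorPerRow m = 2 ^ (m + 1) ∸ m ∸ 2

odd⇒nonZero : ∀ {q} → Odd q → NonZero q
odd⇒nonZero (k , refl) = _

kok-halving : ∀ q m → (m * lengthN q m) / 2 ≡ q * kokPerRow m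
kok-halving q zero    = sym (*-zeroʳ q)
kok-halving q (suc n) = begin
  (suc n * (q * 2 ^ suc n)) / 2 ≡⟨ cong (_/ 2) doubled ⟩
  (q * (suc n * 2 ^ n) * 2) / 2 ≡⟨ m*n/n≡m (q * (suc n * 2 ^ n)) 2 ⟩
  q * (suc n * 2 ^ n)           ∎
  where
  open ≡-Reasoning
  open +-*-Solver
  doubled : suc n * (q * 2 ^ suc n) ≡ q * (suc n * 2 ^ n) * 2
  doubled = solve 3 (λ n q p → (con 1 :+ n) :* (q :* (con 2 :* p))
                              := q :* ((con 1 :+ n) :* p) :* con 2) refl n q (2 ^ n)

kokMults-factored : ∀ q m μq → kokMults q m μq ≡ 2 ^ m * μq + q * kokPerRow m
kokMults-factored q m μq = cong (2 ^ m * μq +_) (kok-halving q m)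

cancel-common : ∀ a q x y .{{_ : NonZero q}} → a + q * x ≡ a + q * y → x ≡ y
cancel-common a q x y eq = *-cancelˡ-≡ x y q (+-cancelˡ-≡ a _ _ eq)

counts-agree⇔rows-agree : ∀ q m μq .{{_ : NonZero q}} →
  (kokMults q m μq ≡ primeFactorMults q m μq) ⇔ (kokPerRow m ≡ primeFactorPerRow m)
counts-agree⇔rows-agree q m μq = mk⇔
  (λ eq → cancel-common (2 ^ m * μq) q _ _
            (trans (sym (kokMults-factored q m μq)) eq))
  (λ eq → trans (kokMults-factored q m μq) (cong (λ x → 2 ^ m * μq + q * x) eq))

twoPow-suc+1 : ∀ n → 2 ^ (suc n + 1) ≡ 4 * 2 ^ n
twoPow-suc+1 n = trans (cong (2 ^_) (+-comm (suc n) 1)) (sym (*-assoc 2 2 (2 ^ n)))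

-- From m = 3 on, Kok's algorithm uses strictly more multiplications per row
-- than the prime-factor lower bound.  (m = 3: 11 < 12; m ≥ 4: bound < 2^(m+1) ≤ m 2^(m-1).)
primeFactor<kok : ∀ m → 3 ≤ m → primeFactorPerRow m < kokPerRow m
primeFactor<kok 0 ()
primeFactor<kok 1 (s≤s ())
primeFactor<kok 2 (s≤s (s≤s ()))
primeFactor<kok 3 _ = ≤-refl
primeFactor<kok (suc (suc (suc (suc k)))) _ = begin-strict
  primeFactorPerRow m  ≤⟨ m∸n≤m (P ∸ m) 2 ⟩
  P ∸ m                <⟨ m<n+o⇒m∸n<o P m {{kok≢0}} P<m+kok ⟩
  kokPerRow m          ∎
  where
  open ≤-Reasoning
  n = suc (suc (suc k))
  m = suc n
  P = 2 ^ (m + 1)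
  kok≢0 : NonZero (kokPerRow m)
  kok≢0 = m*n≢0 m (2 ^ n) {{_}} {{m^n≢0 2 n}}
  P≤kok : P ≤ kokPerRow m
  P≤kok = subst (_≤ kokPerRow m) (sym (twoPow-suc+1 n))
                (*-monoˡ-≤ (2 ^ n) (m≤m+n 4 k))
  P<m+kok : P < m + kokPerRow m
  P<m+kok = <-≤-trans (s≤s P≤kok) (+-monoˡ-≤ (kokPerRow m) {1} {m} (s≤s z≤n))

rows-agree⇔m≤2 : ∀ m → (kokPerRow m ≡ primeFactorPerRow m) ⇔ (m ≤ 2)
rows-agree⇔m≤2 m = mk⇔ (to m) (from m)
  where
  to : ∀ m → kokPerRow m ≡ primeFactorPerRow m → m ≤ 2
  to m eq with m ≤? 2
  ... | yes m≤2 = m≤2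
  ... | no  m≰2 = contradiction (sym eq) (<⇒≢ (primeFactor<kok m (≰⇒> m≰2)))
  from : ∀ m → m ≤ 2 → kokPerRow m ≡ primeFactorPerRow m
  from 0 _ = refl
  from 1 _ = refl
  from 2 _ = refl
  from (suc (suc (suc _))) (s≤s (s≤s ()))

theorem1 : (q m μq : ℕ) → Odd q →
    (kokMults q m μq ≡ primeFactorMults q m μq) ⇔ (m ≤ 2)
theorem1 q m μq odd = mk⇔
  (λ eq → to (rows-agree⇔m≤2 m) (to counts eq))
  (λ m≤2 → from counts (from (rows-agree⇔m≤2 m) m≤2))
  where
  open Equivalence using (to; from)
  instance
    q≢0 : NonZero q
    q≢0 = odd⇒nonZero odd
  counts = counts-agree⇔rows-agree q m μq
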